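{- Let $G$ be a graph with domination number $\gamma$ and let $\alpha\in(0,1]$. Then $\mathrm{pd}_\alpha(G)\le \left\lceil \dfrac{\gamma}{\lfloor 1/\alpha\rfloor}\right\rceil$.
   Context: All graphs are finite and simple. For a graph $G=(V,E)$ and $S\subseteq V$, $N[S]$ denotes the closed neighbourhood of $S$. For $0<\alpha\le 1$, a set $S\subseteq V$ is an $\alpha$-partial dominating set if $|N[S]|\ge \alpha|V|$; $\mathrm{pd}_\alpha(G)$ is the minimum size of an $\alpha$-partial dominating set. The domination number $\gamma$ is the minimum size of a set $D$ with $N[D]=V$.
   Formalization: The parameter α ranges only over the rationals in $(0,1]$. -}

module Defs where

open import Data.Nat using (ℕ; zero; suc; _+_; _*_; _≤_)
open import Data.Nat.DivMod using (_/_)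
open import Data.Bool using (Bool; true; false; _∧_; _∨_; T)
open import Data.Fin using (Fin)
open import Data.Fin.Properties using (_≟_)
open import Data.Fin.Subset using (Subset; ∣_∣)
open import Data.Vec using (tabulate; lookup)
open import Data.List using (allFin)
open import Data.Bool.ListAction using (any)
open import Data.Product using (Σ; _×_)
open import Relation.Nullary.Decidable using (⌊_⌋)
open import Relation.Binary.PropositionalEquality using (_≡_)

record Graph (n : ℕ) : Set where
  field
    adj     : Fin n → Fin n → Bool
    sym     : ∀ u v → adj u v ≡ adj v u
    irrefl  : ∀ v → adj v v ≡ false
open Graph public

N[_] : ∀ {n} → Graph n → Subset n → Subset n
N[_] {n} G S = tabulate λ v →
  any (λ u → lookup S u ∧ (⌊ u ≟ v ⌋ ∨ adj G u v)) (allFin n)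

IsDominating : ∀ {n} → Graph n → Subset n → Set
IsDominating {n} G D = ∣ N[ G ] D ∣ ≡ n

IsDominationNumber : ∀ {n} → Graph n → ℕ → Set
IsDominationNumber G γ =
  Σ (Subset _) (λ D → IsDominating G D × ∣ D ∣ ≡ γ)
  × (∀ D → IsDominating G D → γ ≤ ∣ D ∣)

-- S is an α-partial dominating set, α = p / q:  |N[S]| ≥ (p/q)·n,
-- i.e. p · n ≤ q · |N[S]|.
IsPartialDominating : ∀ {n} → Graph n → (p q : ℕ) → Subset n → Set
IsPartialDominating {n} G p q S = p * n ≤ q * ∣ N[ G ] S ∣

-- ⌊ a / b ⌋ and ⌈ a / b ⌉ on naturals (value 0 when b = 0, never used).
floorDiv : ℕ → ℕ → ℕ
floorDiv a zero    = 0
floorDiv a (suc b) = a / suc b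

ceilDiv : ℕ → ℕ → ℕ
ceilDiv a zero    = 0
ceilDiv a (suc b) = (a + b) / suc b

{-# OPTIONS --safe #-}
-- Let k = ⌊q/p⌋ and split a minimum dominating set D into k parts of size at
-- most ⌈γ/k⌉. The closed neighbourhood of a union is the union of the closed
-- neighbourhoods, so the k parts together dominate all n vertices and the
-- best of them dominates at least n/k ≥ (p/q)·n.
module Submission where

open import Defs hiding (sym)
open import Algebra.Bundles using (CommutativeMonoid)
open import Data.Nat using (ℕ; _≤_; _<_; zero; suc; _+_; _*_; _∸_; z≤n; s≤s; s≤s⁻¹; NonZero; >-nonZero)
open import Data.Nat.Properties
  using ( ≤-reflexive; ≤-trans; ≤-total; +-suc; +-comm; +-identityʳ; *-comm; *-assoc
        ; +-monoˡ-≤; +-monoʳ-≤; +-mono-≤; *-monoˡ-≤; *-monoʳ-≤; m≤n+o⇒m∸n≤o; +-cancelʳ-≤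
        ; module ≤-Reasoning)
open import Data.Nat.DivMod using (_/_; _%_; m≡m%n+[m/n]*n; m%n<n; m/n*n≤m; m≥n⇒m/n>0)
open import Data.Bool using (Bool; _∧_; _∨_)
open import Data.Bool.Properties using (∨-commutativeMonoid; ∧-distribʳ-∨)
open import Data.Bool.ListAction using (any; or)
open import Data.Fin using (Fin)
open import Data.Fin.Properties using (_≟_)
open import Data.Fin.Subset using (Subset; ∣_∣; _∪_; inside; outside)
open import Data.Fin.Subset.Properties using (∣p∣≤∣x∷p∣)
open import Data.List using (List; []; _∷_; allFin)
open import Data.List.Properties using (map-cong)
open import Data.Vec using ([]; _∷_; lookup; tabulate)
open import Data.Vec.Properties using (lookup∘tabulate; tabulate∘lookup; tabulate-cong; lookup-zipWith)
open import Data.Product using (Σ; ∃; ∃₂; _×_; _,_)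
open import Data.Sum using (inj₁; inj₂)
open import Relation.Nullary.Decidable using (⌊_⌋)
open import Relation.Binary.PropositionalEquality
  using (_≡_; refl; sym; trans; cong; cong₂; subst; module ≡-Reasoning)
open import Algebra.Properties.CommutativeSemigroup
  (CommutativeMonoid.commutativeSemigroup ∨-commutativeMonoid) using (interchange)

private
  variable
    n : ℕ

any-∨ : ∀ {A : Set} (f g : A → Bool) (xs : List A) →
  any (λ x → f x ∨ g x) xs ≡ any f xs ∨ any g xs
any-∨ f g []       = refl
any-∨ f g (x ∷ xs) = trans (cong ((f x ∨ g x) ∨_) (any-∨ f g xs)) (interchange (f x) (g x) _ _)

∣p∪q∣≤∣p∣+∣q∣ : (p q : Subset n) → ∣ p ∪ q ∣ ≤ ∣ p ∣ + ∣ q ∣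
∣p∪q∣≤∣p∣+∣q∣ []            []            = z≤n
∣p∪q∣≤∣p∣+∣q∣ (outside ∷ p) (outside ∷ q) = ∣p∪q∣≤∣p∣+∣q∣ p q
∣p∪q∣≤∣p∣+∣q∣ (outside ∷ p) (inside  ∷ q) =
  ≤-trans (s≤s (∣p∪q∣≤∣p∣+∣q∣ p q)) (≤-reflexive (sym (+-suc ∣ p ∣ ∣ q ∣)))
∣p∪q∣≤∣p∣+∣q∣ (inside  ∷ p) (t       ∷ q) =
  s≤s (≤-trans (∣p∪q∣≤∣p∣+∣q∣ p q) (+-monoʳ-≤ ∣ p ∣ (∣p∣≤∣x∷p∣ t q)))

N[p∪q]≡N[p]∪N[q] : (G : Graph n) (p q : Subset n) → N[ G ] (p ∪ q) ≡ N[ G ] p ∪ N[ G ] q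
N[p∪q]≡N[p]∪N[q] {n} G p q = begin
  N[ G ] (p ∪ q)                          ≡⟨ tabulate∘lookup (N[ G ] (p ∪ q)) ⟨
  tabulate (lookup (N[ G ] (p ∪ q)))      ≡⟨ tabulate-cong pointwise ⟩
  tabulate (lookup (N[ G ] p ∪ N[ G ] q)) ≡⟨ tabulate∘lookup (N[ G ] p ∪ N[ G ] q) ⟩
  N[ G ] p ∪ N[ G ] q                     ∎
  where
  open ≡-Reasoning
  pointwise : ∀ v → lookup (N[ G ] (p ∪ q)) v ≡ lookup (N[ G ] p ∪ N[ G ] q) v
  pointwise v = begin
    lookup (N[ G ] (p ∪ q)) v
      ≡⟨ lookup∘tabulate _ v ⟩
    any (λ u → lookup (p ∪ q) u ∧ near u) (allFin n)
      ≡⟨ cong or (map-cong distrib (allFin n)) ⟩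
    any (λ u → lookup p u ∧ near u ∨ lookup q u ∧ near u) (allFin n)
      ≡⟨ any-∨ (λ u → lookup p u ∧ near u) (λ u → lookup q u ∧ near u) (allFin n) ⟩
    any (λ u → lookup p u ∧ near u) (allFin n) ∨ any (λ u → lookup q u ∧ near u) (allFin n)
      ≡⟨ cong₂ _∨_ (lookup∘tabulate _ v) (lookup∘tabulate _ v) ⟨
    lookup (N[ G ] p) v ∨ lookup (N[ G ] q) v
      ≡⟨ lookup-zipWith _∨_ v (N[ G ] p) (N[ G ] q) ⟨
    lookup (N[ G ] p ∪ N[ G ] q) v ∎
    where
    near : Fin n → Bool
    near u = ⌊ u ≟ v ⌋ ∨ adj G u v
    distrib : ∀ u → lookup (p ∪ q) u ∧ near u ≡ lookup p u ∧ near u ∨ lookup q u ∧ near u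
    distrib u = trans (cong (_∧ near u) (lookup-zipWith _∨_ u p q))
                      (∧-distribʳ-∨ (near u) (lookup p u) (lookup q u))

∣N[]∣-subadditive : (G : Graph n) (p q : Subset n) →
  ∣ N[ G ] (p ∪ q) ∣ ≤ ∣ N[ G ] p ∣ + ∣ N[ G ] q ∣
∣N[]∣-subadditive G p q rewrite N[p∪q]≡N[p]∪N[q] G p q =
  ∣p∪q∣≤∣p∣+∣q∣ (N[ G ] p) (N[ G ] q)

∪-split : ∀ m (D : Subset n) → ∃₂ λ A B → A ∪ B ≡ D × ∣ A ∣ ≤ m × ∣ B ∣ ≤ ∣ D ∣ ∸ m
∪-split m       []            = [] , [] , refl , z≤n , z≤n
∪-split m       (outside ∷ D) with ∪-split m D
... | A , B , A∪B≡D , ∣A∣≤m , ∣B∣≤ =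
  outside ∷ A , outside ∷ B , cong (outside ∷_) A∪B≡D , ∣A∣≤m , ∣B∣≤
∪-split zero    (inside  ∷ D) with ∪-split zero D
... | A , B , A∪B≡D , ∣A∣≤0 , ∣B∣≤ =
  outside ∷ A , inside ∷ B , cong (inside ∷_) A∪B≡D , ∣A∣≤0 , s≤s ∣B∣≤
∪-split (suc m) (inside  ∷ D) with ∪-split m D
... | A , B , A∪B≡D , ∣A∣≤m , ∣B∣≤ =
  inside ∷ A , outside ∷ B , cong (inside ∷_) A∪B≡D , s≤s ∣A∣≤m , ∣B∣≤

Subadditive : (Subset n → ℕ) → Set
Subadditive {n} w = (p q : Subset n) → w (p ∪ q) ≤ w p + w q

module _ {w : Subset n → ℕ} (w-sub : Subadditive w) where

  better-of-two : ∀ k m {A B S} → ∣ A ∣ ≤ m → ∣ S ∣ ≤ m → w B ≤ k * w S →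
    ∃ λ T → ∣ T ∣ ≤ m × w (A ∪ B) ≤ suc k * w T
  better-of-two k m {A} {B} {S} ∣A∣≤m ∣S∣≤m wB≤kwS with ≤-total (w S) (w A)
  ... | inj₁ wS≤wA =
    A , ∣A∣≤m , ≤-trans (w-sub A B) (+-monoʳ-≤ (w A) (≤-trans wB≤kwS (*-monoʳ-≤ k wS≤wA)))
  ... | inj₂ wA≤wS =
    S , ∣S∣≤m , ≤-trans (w-sub A B) (+-mono-≤ wA≤wS wB≤kwS)

  subadditive-pigeonhole : ∀ k .{{_ : NonZero k}} m (D : Subset n) → ∣ D ∣ ≤ k * m →
    ∃ λ S → ∣ S ∣ ≤ m × w D ≤ k * w S
  subadditive-pigeonhole (suc zero) m D ∣D∣≤m =
    D , subst (∣ D ∣ ≤_) (+-identityʳ m) ∣D∣≤m , ≤-reflexive (sym (+-identityʳ (w D)))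
  subadditive-pigeonhole (suc (suc k)) m D ∣D∣≤[2+k]m =
    let A , B , A∪B≡D , ∣A∣≤m , ∣B∣≤∣D∣∸m = ∪-split m D
        S , ∣S∣≤m , wB≤[1+k]wS =
          subadditive-pigeonhole (suc k) m B (≤-trans ∣B∣≤∣D∣∸m (m≤n+o⇒m∸n≤o ∣ D ∣ m ∣D∣≤[2+k]m))
    in  subst (λ D → ∃ λ T → ∣ T ∣ ≤ m × w D ≤ suc (suc k) * w T) A∪B≡D
          (better-of-two (suc k) m ∣A∣≤m ∣S∣≤m wB≤[1+k]wS)

m≤n*ceilDiv[m,n] : ∀ m n .{{_ : NonZero n}} → m ≤ n * ceilDiv m n
m≤n*ceilDiv[m,n] m (suc k) = +-cancelʳ-≤ k m (suc k * c) (begin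
  m + k                         ≡⟨ m≡m%n+[m/n]*n (m + k) (suc k) ⟩
  (m + k) % suc k + c * suc k   ≤⟨ +-monoˡ-≤ (c * suc k) (s≤s⁻¹ (m%n<n (m + k) (suc k))) ⟩
  k + c * suc k                 ≡⟨ +-comm k (c * suc k) ⟩
  c * suc k + k                 ≡⟨ cong (_+ k) (*-comm c (suc k)) ⟩
  suc k * c + k                 ∎)
  where
  open ≤-Reasoning
  c : ℕ
  c = ceilDiv m (suc k)

k*p≤q⇒n≤k*s⇒p*n≤q*s : ∀ k p {q n s} → k * p ≤ q → n ≤ k * s → p * n ≤ q * s
k*p≤q⇒n≤k*s⇒p*n≤q*s k p {q} {n} {s} k*p≤q n≤k*s = begin
  p * n        ≤⟨ *-monoʳ-≤ p n≤k*s ⟩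
  p * (k * s)  ≡⟨ *-assoc p k s ⟨
  p * k * s    ≡⟨ cong (_* s) (*-comm p k) ⟩
  k * p * s    ≤⟨ *-monoˡ-≤ s k*p≤q ⟩
  q * s        ∎
  where open ≤-Reasoning

mainTheorem7 : ∀ {n} (G : Graph n) (γ p q : ℕ) → 0 < p → p ≤ q →
    IsDominationNumber G γ →
    Σ (Subset n) (λ S → IsPartialDominating G p q S
      × ∣ S ∣ ≤ ceilDiv γ (floorDiv q p))
mainTheorem7 G γ p@(suc _) q _ p≤q ((D , N[D]≡V , ∣D∣≡γ) , _) =
  let instance
        k≢0 : NonZero (q / p)
        k≢0 = >-nonZero (m≥n⇒m/n>0 p≤q)
      k = q / p
      m = ceilDiv γ k
      ∣D∣≤k*m = subst (_≤ k * m) (sym ∣D∣≡γ) (m≤n*ceilDiv[m,n] γ k)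
      S , ∣S∣≤m , ∣N[D]∣≤k*∣N[S]∣ =
        subadditive-pigeonhole (∣N[]∣-subadditive G) k m D ∣D∣≤k*m
      n≤k*∣N[S]∣ = subst (_≤ k * ∣ N[ G ] S ∣) N[D]≡V ∣N[D]∣≤k*∣N[S]∣
  in  S , k*p≤q⇒n≤k*s⇒p*n≤q*s k p (m/n*n≤m q p) n≤k*∣N[S]∣ , ∣S∣≤m
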